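{- Let $G=G(V,E)$ be a simple graph. The Interval-Reversal random walk on the acyclic orientations of $G$ is a simple random walk on the graph $\mathrm{AO}^{\mathrm{inter}}_G$, which is a connected $|E|$-regular graph whose vertex set is the set of acyclic orientations of $G$, and its stationary distribution is uniform: $\pi^{\mathrm{IR}}_O=1/|\chi_G(-1)|$ for every acyclic orientation $O$ of $G$.
   Context: Acyclic orientations $O$ of $G$ orient every edge with no directed cycle; $O[E]$ is the set of directed edges, $\le_O$ the partial order generated ($(x,y)\in O[E]\Rightarrow x<_O y$). For $\{u,v\}\in E$ with $(u,v)\in O[E]$, $O_{\{u,v\}}$ is the orientation obtained from $O$ by reversing every directed edge $(x,y)\in O[E]$ with $u\le_O x<_O y\le_O v$ and keeping all others. $\mathrm{AO}^{\mathrm{inter}}_G$ is the simple graph on the acyclic orientations of $G$ in which $O_1,O_2$ are adjacent iff $(O_1)_{\{u,v\}}=O_2$ for some $\{u,v\}\in E$. Interval-Reversal random walk: start from any acyclic orientation $O_0$; for $t\ge1$ choose $\{u,v\}\in E$ uniformly at random and set $O_t=(O_{t-1})_{\{u,v\}}$. $\chi_G$ is the chromatic polynomial of $G$, so $|\chi_G(-1)|$ is the number of acyclic orientations of $G$. A simple random walk on a graph moves at each step to a uniformly random neighbor.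
   Formalization: Uniqueness of the stationary distribution $\pi^{\mathrm{IR}}$ is stated only among probability distributions on the acyclic orientations that take rational values. -}

module Defs where

open import Data.Nat as ℕ using (ℕ; zero; suc)
open import Data.Fin using (Fin; _<_)
open import Data.Fin.Properties using (any?)
open import Data.Bool using (Bool; true; false; not; if_then_else_)
open import Data.Bool.Properties using () renaming (_≟_ to _≟B_)
open import Data.Product using (Σ; ∃; _×_; _,_; proj₁; proj₂)
open import Data.Product.Properties using () renaming (≡-dec to ×-≡-dec)
open import Data.List as List using (List; []; _∷_; length; lookup; filter; map; foldr; _++_; allFin)
open import Data.List.Relation.Unary.All using (All)
open import Data.List.Relation.Unary.Unique.Propositional using (Unique)
open import Data.Vec as Vec using (Vec; tabulate)
open import Data.Vec.Properties using () renaming (≡-dec to Vec-≡-dec)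
open import Data.Integer using (+_)
open import Data.Rational as ℚ using (ℚ; 0ℚ; _/_)
open import Relation.Nullary using (¬_; Dec; yes; no; does)
open import Relation.Nullary.Decidable using (_×-dec_; ¬?)
open import Relation.Binary.PropositionalEquality using (_≡_)
open import Relation.Binary.Construct.Closure.ReflexiveTransitive using (Star)

-- Finite simple graphs: vertex set Fin n, edge set a duplicate-free list
-- of pairs (u , v) with u < v (each unordered edge {u,v} listed once).

record SimpleGraph : Set where
  field
    n       : ℕ
    edges   : List (Fin n × Fin n)
    ordered : All (λ e → proj₁ e < proj₂ e) edges
    unique  : Unique edges

module _ (G : SimpleGraph) where
  open SimpleGraph G

  #E : ℕ
  #E = length edges

  -- An orientation: one bit per edge; for the i-th edge (u , v),
  -- true means u → v and false means v → u.
  Orientation : Set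
  Orientation = Vec Bool #E

  arcOf : Orientation → Fin #E → Fin n × Fin n
  arcOf O i with Vec.lookup O i
  ... | true  = lookup edges i
  ... | false = proj₂ (lookup edges i) , proj₁ (lookup edges i)

  Arc : Orientation → Fin n → Fin n → Set
  Arc O x y = ∃ λ i → arcOf O i ≡ (x , y)

  _≤[_]_ : Fin n → Orientation → Fin n → Set
  x ≤[ O ] y = Star (Arc O) x y

  Acyclic : Orientation → Set
  Acyclic O = ¬ (∃ λ i → proj₂ (arcOf O i) ≤[ O ] proj₁ (arcOf O i))

  -- Decision procedures for ≤_O (they exist; see the theorem).
  ReachDec : Set
  ReachDec = ∀ O x y → Dec (x ≤[ O ] y)

  -- The i-th arc (x , y) of O lies in the interval of the j-th edge
  -- (u , v) of O:  u ≤_O x <_O y ≤_O v  (x <_O y holds as (x,y) ∈ O[E]).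
  InInterval : Orientation → Fin #E → Fin #E → Set
  InInterval O j i =
    (proj₁ (arcOf O j) ≤[ O ] proj₁ (arcOf O i)) ×
    (proj₂ (arcOf O i) ≤[ O ] proj₂ (arcOf O j))

  module WithDec (dec : ReachDec) where

    inInterval? : ∀ O j i → Dec (InInterval O j i)
    inInterval? O j i = dec O _ _ ×-dec dec O _ _

    rev : Orientation → Fin #E → Orientation
    rev O j = tabulate λ i →
      if does (inInterval? O j i) then not (Vec.lookup O i) else Vec.lookup O i

    acyclic? : ∀ O → Dec (Acyclic O)
    acyclic? O = ¬? (any? λ i → dec O _ _)

    _≟O_ : (O O′ : Orientation) → Dec (O ≡ O′)
    _≟O_ = Vec-≡-dec _≟B_

    Adj : Orientation → Orientation → Set
    Adj O₁ O₂ = ∃ λ j → rev O₁ j ≡ O₂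

    adj? : ∀ O₁ O₂ → Dec (Adj O₁ O₂)
    adj? O₁ O₂ = any? λ j → rev O₁ j ≟O O₂

    allVecs : (k : ℕ) → List (Vec Bool k)
    allVecs zero = Vec.[] ∷ []
    allVecs (suc k) = map (true Vec.∷_) (allVecs k) ++ map (false Vec.∷_) (allVecs k)

    AOs : List Orientation
    AOs = filter acyclic? (allVecs #E)

    -- number of acyclic orientations ( = |χ_G(-1)| )
    #AO : ℕ
    #AO = length AOs

    deg : Orientation → ℕ
    deg O = length (filter (adj? O) AOs)

    -- a / d as a rational (0 if d = 0; only used with d ≠ 0)
    ratio : ℕ → ℕ → ℚ
    ratio a zero = 0ℚ
    ratio a (suc d) = (+ a) / suc d

    P-IR : Orientation → Orientation → ℚ
    P-IR O O′ = ratio (length (filter (λ j → rev O j ≟O O′) (allFin #E))) #E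

    P-SRW : Orientation → Orientation → ℚ
    P-SRW O O′ = if does (adj? O O′) then ratio 1 (deg O) else 0ℚ

    sumℚ : List ℚ → ℚ
    sumℚ = foldr ℚ._+_ 0ℚ

    IsDistribution : (Orientation → ℚ) → Set
    IsDistribution μ = (∀ O → Acyclic O → 0ℚ ℚ.≤ μ O) × (sumℚ (map μ AOs) ≡ ℚ.1ℚ)

    IsStationaryIR : (Orientation → ℚ) → Set
    IsStationaryIR μ = ∀ O′ → Acyclic O′ → sumℚ (map (λ O → μ O ℚ.* P-IR O O′) AOs) ≡ μ O′

module Submission where

-- For an acyclic O and an arc (u , v) of O, an O_{uv}-path is an O-path unless
-- it crosses the reversed interval [u , v]; hence a cycle of O_{uv} would give
-- an O-path from v back to u, and O_{uv} is acyclic.  The interval of (v , u)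
-- in O_{uv} consists of the same edges, so reversal is an involution; the edge
-- {u,v} itself always flips, so there are no loops; and edges with the same
-- reversal lie in each other's intervals, hence coincide by antisymmetry of
-- ≤_O.  So O ↦ O_e is injective on E and AO^inter_G is a simple |E|-regular
-- graph on which the Interval-Reversal walk is the simple random walk.  It is
-- connected: reversing a disagreeing edge with minimal interval moves O one
-- edge closer to any target.  The walk matrix is symmetric with unit column
-- sums, so the uniform distribution is stationary, and the maximum principle
-- on the connected graph shows that every stationary distribution is uniform.

open import Defs
open import Data.Nat using (ℕ; zero; suc; _≤_; _<_; z≤n; s≤s)
open import Data.Nat.Properties using (m≤n⇒m≤1+n)
open import Data.Nat.Induction using (<-wellFounded)
open import Induction.WellFounded using (Acc; acc)
open import Data.Fin as Fin using (Fin)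
open import Data.Fin.Properties using (any?) renaming (_≟_ to _≟F_)
import Data.Fin.Properties as FinP
open import Data.Bool using (Bool; true; false; not; if_then_else_)
open import Data.Bool.Properties using (not-involutive; not-¬; ¬-not) renaming (_≟_ to _≟B_)
open import Data.Product using (∃; _×_; _,_; proj₁; proj₂; swap)
open import Data.Sum using (_⊎_; inj₁; inj₂) renaming ([_,_]′ to either)
open import Data.Empty using (⊥-elim)
open import Data.List as List using (List; []; _∷_; length; filter; map; foldr; tabulate; allFin)
open import Data.List.Properties using (length-tabulate)
import Data.List.Relation.Unary.All as All
open import Data.List.Relation.Unary.AllPairs using ([]; _∷_)
open import Data.List.Relation.Unary.Any using (here; there)
open import Data.List.Membership.Propositional using (_∈_)
open import Data.List.Membership.Propositional.Properties
  using (∈-map⁺; ∈-map⁻; ∈-allFin; ∈-lookup; ∈-filter⁺; ∈-filter⁻; ∈-tabulate⁺; ∈-tabulate⁻;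
         ∈-++⁺ˡ; ∈-++⁺ʳ)
open import Data.List.Membership.Propositional.Properties.WithK using (unique∧set⇒bag)
open import Data.List.Relation.Binary.BagAndSetEquality using (∼bag⇒↭)
open import Data.List.Relation.Binary.Permutation.Propositional.Properties using (↭-length)
open import Data.List.Relation.Unary.Unique.Propositional using (Unique)
import Data.List.Relation.Unary.Unique.Propositional.Properties as Unique
open import Data.Vec as Vec using (Vec)
open import Data.Vec.Properties using (lookup∘tabulate; tabulate∘lookup; tabulate-cong)
open import Data.Integer as ℤ using (+_)
import Data.Integer.Properties as ℤP
open import Data.Rational as ℚ using (ℚ; mkℚ; _/_; 0ℚ; 1ℚ)
import Data.Rational.Properties as ℚP
import Data.Nat.Coprimality as Coprime
open import Relation.Nullary using (¬_; Dec; yes; no; does)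
open import Relation.Nullary.Decidable using (map′; ¬?; _×-dec_; dec-true; dec-false; decidable-stable)
open import Relation.Unary using (Pred; Decidable)
open import Relation.Binary.PropositionalEquality
open import Relation.Binary.Construct.Closure.ReflexiveTransitive as Star using (Star; ε; _◅_; _◅◅_)
open import Function.Bundles using (_⇔_; mk⇔)

-- If the elements of a duplicate-free list xs satisfying P are
-- enumerated without repetition by f : Fin m → A, then exactly m of them pass
-- the filter (the two lists are duplicate-free with the same members).
length-filter-enumerated :
  ∀ {a p} {A : Set a} {P : Pred A p} (P? : Decidable P) (xs : List A) → Unique xs →
  ∀ {m} (f : Fin m → A) → (∀ {i j} → f i ≡ f j → i ≡ j) →
  (∀ x → P x → ∃ λ j → f j ≡ x) → (∀ j → f j ∈ xs) → (∀ j → P (f j)) →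
  length (filter P? xs) ≡ m
length-filter-enumerated P? xs xs-unique f f-injective f-onto f-in f-sat =
  trans (↭-length (∼bag⇒↭ (unique∧set⇒bag (Unique.filter⁺ P? xs-unique)
                                          (Unique.tabulate⁺ f-injective) (mk⇔ to from))))
        (length-tabulate f)
  where
  to : ∀ {z} → z ∈ filter P? xs → z ∈ tabulate f
  to z∈ with f-onto _ (proj₂ (∈-filter⁻ P? {xs = xs} z∈))
  ... | j , refl = ∈-tabulate⁺ j
  from : ∀ {z} → z ∈ tabulate f → z ∈ filter P? xs
  from z∈ with ∈-tabulate⁻ z∈
  ... | j , refl = ∈-filter⁺ P? (f-in j) (f-sat j)

-- Both termination
-- measures of the connectivity argument decrease by this lemma.
module _ {a p q} {A : Set a} {P : Pred A p} {Q : Pred A q}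
         (P? : Decidable P) (Q? : Decidable Q) (Q⊆P : ∀ x → Q x → P x) where

  length-filter-mono : ∀ xs → length (filter Q? xs) ≤ length (filter P? xs)
  length-filter-mono [] = z≤n
  length-filter-mono (y ∷ ys) with P? y | Q? y
  ... | yes _ | yes _ = s≤s (length-filter-mono ys)
  ... | yes _ | no _ = m≤n⇒m≤1+n (length-filter-mono ys)
  ... | no ¬py | yes qy = ⊥-elim (¬py (Q⊆P y qy))
  ... | no _ | no _ = length-filter-mono ys

  length-filter-mono-< : ∀ {x} xs → x ∈ xs → P x → ¬ Q x →
                         length (filter Q? xs) < length (filter P? xs)
  length-filter-mono-< (y ∷ ys) (here refl) px ¬qx with P? y | Q? y
  ... | yes _ | yes qx = ⊥-elim (¬qx qx)
  ... | yes _ | no _ = s≤s (length-filter-mono ys)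
  ... | no ¬px | _ = ⊥-elim (¬px px)
  length-filter-mono-< (y ∷ ys) (there x∈) px ¬qx with P? y | Q? y
  ... | yes _ | yes _ = s≤s (length-filter-mono-< ys x∈ px ¬qx)
  ... | yes _ | no _ = m≤n⇒m≤1+n (length-filter-mono-< ys x∈ px ¬qx)
  ... | no ¬py | yes qy = ⊥-elim (¬py (Q⊆P y qy))
  ... | no _ | no _ = length-filter-mono-< ys x∈ px ¬qx

lookup-injective : ∀ {A : Set} {xs : List A} → Unique xs →
                   ∀ {i j} → List.lookup xs i ≡ List.lookup xs j → i ≡ j
lookup-injective (_ ∷ _) {Fin.zero} {Fin.zero} _ = refl
lookup-injective (x∉ ∷ _) {Fin.zero} {Fin.suc j} e = ⊥-elim (All.lookup x∉ (∈-lookup j) e)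
lookup-injective (x∉ ∷ _) {Fin.suc i} {Fin.zero} e = ⊥-elim (All.lookup x∉ (∈-lookup i) (sym e))
lookup-injective (_ ∷ u) {Fin.suc i} {Fin.suc j} e = cong Fin.suc (lookup-injective u e)

vec-ext : ∀ {A : Set} {k} (xs ys : Vec A k) → (∀ i → Vec.lookup xs i ≡ Vec.lookup ys i) → xs ≡ ys
vec-ext xs ys h = begin
  xs                           ≡⟨ sym (tabulate∘lookup xs) ⟩
  Vec.tabulate (Vec.lookup xs) ≡⟨ tabulate-cong h ⟩
  Vec.tabulate (Vec.lookup ys) ≡⟨ tabulate∘lookup ys ⟩
  ys                           ∎
  where open ≡-Reasoning

positive⇒suc : ∀ {m} → 1 ≤ m → ∃ λ e → m ≡ suc e
positive⇒suc {suc e} _ = e , refl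

-- Reachability along the arcs of a finite list over a type with decidable
-- equality is decidable: a path using the head arc (p , q) splits into a path
-- to p and a path from q that avoid it.  This yields decidability of ≤_O.
module FiniteReach {v} {V : Set v} (_≟_ : (x y : V) → Dec (x ≡ y)) where

  Step : List (V × V) → V → V → Set v
  Step arcs x y = (x , y) ∈ arcs

  weaken : ∀ {a arcs x y} → Star (Step arcs) x y → Star (Step (a ∷ arcs)) x y
  weaken = Star.map there

  split : ∀ {p q arcs x y} → Star (Step ((p , q) ∷ arcs)) x y →
          Star (Step arcs) x y ⊎ (Star (Step arcs) x p × Star (Step arcs) q y)
  split ε = inj₁ ε
  split (here refl ◅ s) with split s
  ... | inj₁ s′ = inj₂ (ε , s′)
  ... | inj₂ (_ , s₂) = inj₂ (ε , s₂)
  split (there r ◅ s) with split s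
  ... | inj₁ s′ = inj₁ (r ◅ s′)
  ... | inj₂ (s₁ , s₂) = inj₂ (r ◅ s₁ , s₂)

  no-arcs : ∀ {x y} → Star (Step []) x y → x ≡ y
  no-arcs ε = refl
  no-arcs (() ◅ _)

  reachable? : ∀ arcs x y → Dec (Star (Step arcs) x y)
  reachable? [] x y with x ≟ y
  ... | yes refl = yes ε
  ... | no x≢y = no λ s → x≢y (no-arcs s)
  reachable? ((p , q) ∷ arcs) x y
    with reachable? arcs x y | reachable? arcs x p | reachable? arcs q y
  ... | yes s | _ | _ = yes (weaken s)
  ... | no _ | yes s₁ | yes s₂ = yes (weaken s₁ ◅◅ (here refl ◅ weaken s₂))
  ... | no ¬s | no ¬s₁ | _ = no λ s → either ¬s (λ { (s₁ , _) → ¬s₁ s₁ }) (split s)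
  ... | no ¬s | yes _ | no ¬s₂ = no λ s → either ¬s (λ { (_ , s₂) → ¬s₂ s₂ }) (split s)

module RationalSums where
  open import Data.Rational using (_+_; _*_) renaming (_≤_ to _≤ℚ_; _<_ to _<ℚ_)

  sum : List ℚ → ℚ
  sum = foldr _+_ 0ℚ

  times : ℕ → ℚ → ℚ
  times zero c = 0ℚ
  times (suc k) c = c + times k c

  nat-as-mkℚ : ∀ k → (+ k) / 1 ≡ mkℚ (+ k) 0 (Coprime.sym (Coprime.1-coprimeTo k))
  nat-as-mkℚ k = ℚP.↥p/↧p≡p (mkℚ (+ k) 0 (Coprime.sym (Coprime.1-coprimeTo k)))

  unit-fraction-as-mkℚ : ∀ e → (+ 1) / suc e ≡ mkℚ (+ 1) e (Coprime.1-coprimeTo (suc e))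
  unit-fraction-as-mkℚ e = ℚP.↥p/↧p≡p (mkℚ (+ 1) e (Coprime.1-coprimeTo (suc e)))

  times-one : ∀ k → times k 1ℚ ≡ (+ k) / 1
  times-one zero = refl
  times-one (suc k) =
    trans (cong (λ z → 1ℚ + z) (trans (times-one k) (nat-as-mkℚ k)))
          (ℚP./-cong {p₁ = + 1 ℤ.+ (+ k) ℤ.* (+ 1)} {q₁ = 1} {q₂ = 1}
                     (cong (λ z → + 1 ℤ.+ z) (ℤP.*-identityʳ (+ k))) refl)

  times-scale : ∀ k c → times k c ≡ c * times k 1ℚ
  times-scale zero c = sym (ℚP.*-zeroʳ c)
  times-scale (suc k) c = begin
    c + times k c             ≡⟨ cong (λ z → c + z) (times-scale k c) ⟩
    c + c * times k 1ℚ        ≡⟨ cong (_+ c * times k 1ℚ) (sym (ℚP.*-identityʳ c)) ⟩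
    c * 1ℚ + c * times k 1ℚ   ≡⟨ sym (ℚP.*-distribˡ-+ c 1ℚ (times k 1ℚ)) ⟩
    c * (1ℚ + times k 1ℚ)     ∎
    where open ≡-Reasoning

  unit-fraction-inverse : ∀ e → ((+ 1) / suc e) * ((+ suc e) / 1) ≡ 1ℚ
  unit-fraction-inverse e rewrite unit-fraction-as-mkℚ e | nat-as-mkℚ (suc e) =
    ℚP.*-inverseˡ (mkℚ (+ suc e) 0 (Coprime.sym (Coprime.1-coprimeTo (suc e))))

  times-unit-fraction : ∀ e → times (suc e) ((+ 1) / suc e) ≡ 1ℚ
  times-unit-fraction e = begin
    times (suc e) r            ≡⟨ times-scale (suc e) r ⟩
    r * times (suc e) 1ℚ       ≡⟨ cong (r *_) (times-one (suc e)) ⟩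
    r * ((+ suc e) / 1)        ≡⟨ unit-fraction-inverse e ⟩
    1ℚ                         ∎
    where
    open ≡-Reasoning
    r : ℚ
    r = (+ 1) / suc e

  unit-fraction-cancel : ∀ e {a b} → a * ((+ 1) / suc e) ≡ b * ((+ 1) / suc e) → a ≡ b
  unit-fraction-cancel e {a} {b} h = begin
    a              ≡⟨ sym (ℚP.*-identityʳ a) ⟩
    a * 1ℚ         ≡⟨ cong (a *_) (sym (unit-fraction-inverse e)) ⟩
    a * (r * N)    ≡⟨ sym (ℚP.*-assoc a r N) ⟩
    (a * r) * N    ≡⟨ cong (_* N) h ⟩
    (b * r) * N    ≡⟨ ℚP.*-assoc b r N ⟩
    b * (r * N)    ≡⟨ cong (b *_) (unit-fraction-inverse e) ⟩
    b * 1ℚ         ≡⟨ ℚP.*-identityʳ b ⟩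
    b              ∎
    where
    open ≡-Reasoning
    r : ℚ
    r = (+ 1) / suc e
    N : ℚ
    N = (+ suc e) / 1

  inverse-unique : ∀ {a b N} → a * N ≡ 1ℚ → b * N ≡ 1ℚ → a ≡ b
  inverse-unique {a} {b} {N} aN≡1 bN≡1 = begin
    a              ≡⟨ sym (ℚP.*-identityʳ a) ⟩
    a * 1ℚ         ≡⟨ cong (a *_) (sym bN≡1) ⟩
    a * (b * N)    ≡⟨ cong (a *_) (ℚP.*-comm b N) ⟩
    a * (N * b)    ≡⟨ sym (ℚP.*-assoc a N b) ⟩
    (a * N) * b    ≡⟨ cong (_* b) aN≡1 ⟩
    1ℚ * b         ≡⟨ ℚP.*-identityˡ b ⟩
    b              ∎
    where open ≡-Reasoning

  sum-cong : ∀ {A : Set} (xs : List A) (f g : A → ℚ) → (∀ {x} → x ∈ xs → f x ≡ g x) →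
             sum (map f xs) ≡ sum (map g xs)
  sum-cong [] f g h = refl
  sum-cong (x ∷ xs) f g h = cong₂ _+_ (h (here refl)) (sum-cong xs f g (λ y∈ → h (there y∈)))

  sum-const : ∀ {A : Set} (xs : List A) c → sum (map (λ _ → c) xs) ≡ times (length xs) c
  sum-const [] c = refl
  sum-const (x ∷ xs) c = cong (λ z → c + z) (sum-const xs c)

  sum-indicator : ∀ {A : Set} {p} {P : Pred A p} (P? : Decidable P) (c r : ℚ) (xs : List A) →
    sum (map (λ x → c * (if does (P? x) then r else 0ℚ)) xs) ≡ c * times (length (filter P? xs)) r
  sum-indicator P? c r [] = sym (ℚP.*-zeroʳ c)
  sum-indicator P? c r (x ∷ xs) with P? x
  ... | yes _ = trans (cong (λ z → c * r + z) (sum-indicator P? c r xs)) (sym (ℚP.*-distribˡ-+ c r _))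
  ... | no _ = trans (cong₂ _+_ (ℚP.*-zeroʳ c) (sum-indicator P? c r xs)) (ℚP.+-identityˡ _)

  sum-mono : ∀ {A : Set} (xs : List A) (f g : A → ℚ) → (∀ {x} → x ∈ xs → f x ≤ℚ g x) →
             sum (map f xs) ≤ℚ sum (map g xs)
  sum-mono [] f g h = ℚP.≤-refl
  sum-mono (x ∷ xs) f g h = ℚP.+-mono-≤ (h (here refl)) (sum-mono xs f g (λ y∈ → h (there y∈)))

  sum-mono-< : ∀ {A : Set} (xs : List A) (f g : A → ℚ) → (∀ {x} → x ∈ xs → f x ≤ℚ g x) →
               ∀ {y} → y ∈ xs → f y <ℚ g y → sum (map f xs) <ℚ sum (map g xs)
  sum-mono-< (x ∷ xs) f g h (here refl) lt =
    ℚP.+-mono-<-≤ lt (sum-mono xs f g (λ y∈ → h (there y∈)))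
  sum-mono-< (x ∷ xs) f g h (there y∈) lt =
    ℚP.+-mono-≤-< (h (here refl)) (sum-mono-< xs f g (λ z∈ → h (there z∈)) y∈ lt)

  sum-equality-pointwise : ∀ {A : Set} (xs : List A) (f g : A → ℚ) → (∀ {x} → x ∈ xs → f x ≤ℚ g x) →
    sum (map f xs) ≡ sum (map g xs) → ∀ {y} → y ∈ xs → f y ≡ g y
  sum-equality-pointwise xs f g h sums≡ {y} y∈ with g y ℚP.≤? f y
  ... | yes g≤f = ℚP.≤-antisym (h y∈) g≤f
  ... | no g≰f = ⊥-elim (ℚP.<-irrefl sums≡ (sum-mono-< xs f g h y∈ (ℚP.≰⇒> g≰f)))

  argmax : ∀ {A : Set} (f : A → ℚ) (x : A) (xs : List A) →
           ∃ λ y → y ∈ (x ∷ xs) × (∀ {z} → z ∈ (x ∷ xs) → f z ≤ℚ f y)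
  argmax f x [] = x , here refl , λ { (here refl) → ℚP.≤-refl }
  argmax f x (x′ ∷ xs) with argmax f x′ xs
  ... | y , y∈ , max with ℚP.≤-total (f x) (f y)
  ...   | inj₁ fx≤fy = y , there y∈ , λ { (here refl) → fx≤fy ; (there z∈) → max z∈ }
  ...   | inj₂ fy≤fx =
    x , here refl , λ { (here refl) → ℚP.≤-refl ; (there z∈) → ℚP.≤-trans (max z∈) fy≤fx }

module Geometry (G : SimpleGraph) where
  open SimpleGraph G

  _⊑[_]_ : Fin n → Orientation G → Fin n → Set
  x ⊑[ O ] y = Star (Arc G O) x y

  directed : ∀ {A : Set} → Bool → A × A → A × A
  directed true e = e
  directed false e = swap e

  arcOf-directed : ∀ O i → arcOf G O i ≡ directed (Vec.lookup O i) (List.lookup edges i)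
  arcOf-directed O i with Vec.lookup O i
  ... | true = refl
  ... | false = refl

  arcOf-agree : ∀ O O′ i → Vec.lookup O′ i ≡ Vec.lookup O i → arcOf G O′ i ≡ arcOf G O i
  arcOf-agree O O′ i e rewrite arcOf-directed O i | arcOf-directed O′ i | e = refl

  arcOf-disagree : ∀ O O′ i → Vec.lookup O′ i ≡ not (Vec.lookup O i) → arcOf G O′ i ≡ swap (arcOf G O i)
  arcOf-disagree O O′ i e rewrite arcOf-directed O i | arcOf-directed O′ i | e with Vec.lookup O i
  ... | true = refl
  ... | false = refl

  -- no edge of G is the reverse of an edge, as every edge is listed as u < v
  edge≢reversed-edge : ∀ j k → ¬ List.lookup edges j ≡ swap (List.lookup edges k)
  edge≢reversed-edge j k e =
    FinP.<-asym (ordered-at j) (subst (λ p → proj₂ p Fin.< proj₁ p) (sym e) (ordered-at k))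
    where
    ordered-at : ∀ i → proj₁ (List.lookup edges i) Fin.< proj₂ (List.lookup edges i)
    ordered-at i = All.lookup ordered (∈-lookup i)

  arcOf-injective : ∀ O {j k} → arcOf G O j ≡ arcOf G O k → j ≡ k
  arcOf-injective O {j} {k} e rewrite arcOf-directed O j | arcOf-directed O k
    with Vec.lookup O j | Vec.lookup O k
  ... | true | true = lookup-injective unique e
  ... | false | false = lookup-injective unique (cong swap e)
  ... | true | false = ⊥-elim (edge≢reversed-edge j k e)
  ... | false | true = ⊥-elim (edge≢reversed-edge k j (sym e))

  arc-path : ∀ O i → proj₁ (arcOf G O i) ⊑[ O ] proj₂ (arcOf G O i)
  arc-path O i = (i , refl) ◅ ε

  -- ≤_O is decidable: it is reachability along the finite list of arcs of O
  reachDec : ReachDec G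
  reachDec O x y =
    map′ (Star.map from-list) (Star.map to-list) (FiniteReach.reachable? _≟F_ arcList x y)
    where
    arcList : List (Fin n × Fin n)
    arcList = map (arcOf G O) (allFin (#E G))
    to-list : ∀ {x y} → Arc G O x y → (x , y) ∈ arcList
    to-list (i , e) = subst (_∈ arcList) e (∈-map⁺ (arcOf G O) (∈-allFin i))
    from-list : ∀ {x y} → (x , y) ∈ arcList → Arc G O x y
    from-list x∈ with ∈-map⁻ (arcOf G O) x∈
    ... | i , _ , e = i , sym e

  ⊑-antisym : ∀ {O} → Acyclic G O → ∀ {x y} → x ⊑[ O ] y → y ⊑[ O ] x → x ≡ y
  ⊑-antisym {O} ac ε _ = refl
  ⊑-antisym {O} ac ((i , e) ◅ s) t =
    ⊥-elim (ac (i , subst (λ p → proj₂ p ⊑[ O ] proj₁ p) (sym e) (s ◅◅ t)))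

module IntervalReversal (G : SimpleGraph) (dec : ReachDec G) where
  open Geometry G
  open WithDec G dec

  E : ℕ
  E = #E G

  reversed-bit : ∀ {O j i} → InInterval G O j i → Vec.lookup (rev O j) i ≡ not (Vec.lookup O i)
  reversed-bit {O} {j} {i} inI =
    trans (lookup∘tabulate _ i) (cong (λ b → if b then _ else _) (dec-true (inInterval? O j i) inI))

  kept-bit : ∀ {O j i} → ¬ InInterval G O j i → Vec.lookup (rev O j) i ≡ Vec.lookup O i
  kept-bit {O} {j} {i} ¬inI =
    trans (lookup∘tabulate _ i) (cong (λ b → if b then _ else _) (dec-false (inInterval? O j i) ¬inI))

  own-interval : ∀ O j → InInterval G O j j
  own-interval O j = ε , ε

  module Reversal (O : Orientation G) (j : Fin E) where
    O′ : Orientation G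
    O′ = rev O j

    u v : Fin (SimpleGraph.n G)
    u = proj₁ (arcOf G O j)
    v = proj₂ (arcOf G O j)

    arc-reversed : ∀ {i x z} → InInterval G O j i → arcOf G O′ i ≡ (x , z) → arcOf G O i ≡ (z , x)
    arc-reversed {i} inI e = cong swap (trans (sym (arcOf-disagree O O′ i (reversed-bit inI))) e)

    arc-kept : ∀ {i x z} → ¬ InInterval G O j i → arcOf G O′ i ≡ (x , z) → arcOf G O i ≡ (x , z)
    arc-kept {i} ¬inI e = trans (sym (arcOf-agree O O′ i (kept-bit ¬inI))) e

    lift-path : ∀ {x y} → x ⊑[ O′ ] y → x ⊑[ O ] y ⊎ (x ⊑[ O ] v × u ⊑[ O ] y)
    lift-path ε = inj₁ ε
    lift-path {x} (_◅_ {j = z} (i , e) s) with inInterval? O j i | lift-path s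
    ... | yes (u⊑ , ⊑v) | rest =
      inj₂ (subst (λ a → proj₂ a ⊑[ O ] v) eqi ⊑v , either (u⊑z ◅◅_) proj₂ rest)
      where
      eqi : arcOf G O i ≡ (z , x)
      eqi = arc-reversed (u⊑ , ⊑v) e
      u⊑z : u ⊑[ O ] z
      u⊑z = subst (λ a → u ⊑[ O ] proj₁ a) eqi u⊑
    ... | no ¬inI | inj₁ t = inj₁ ((i , arc-kept ¬inI e) ◅ t)
    ... | no ¬inI | inj₂ (t₁ , t₂) = inj₂ ((i , arc-kept ¬inI e) ◅ t₁ , t₂)

    path-in-interval : ∀ {x y} → u ⊑[ O ] x → x ⊑[ O′ ] y → y ⊑[ O ] v → y ⊑[ O ] x × x ⊑[ O ] v
    path-in-interval u⊑x ε y⊑v = ε , y⊑v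
    path-in-interval u⊑x (_◅_ {j = z} (i , e) s) y⊑v with inInterval? O j i
    ... | yes (u⊑ , ⊑v) =
      let eqi = arc-reversed (u⊑ , ⊑v) e
          (y⊑z , _) = path-in-interval (subst (λ a → u ⊑[ O ] proj₁ a) eqi u⊑) s y⊑v
      in y⊑z ◅◅ ((i , eqi) ◅ ε) , subst (λ a → proj₂ a ⊑[ O ] v) eqi ⊑v
    ... | no ¬inI =
      let eqi = arc-kept ¬inI e
          (_ , z⊑v) = path-in-interval (u⊑x ◅◅ ((i , eqi) ◅ ε)) s y⊑v
      in ⊥-elim (¬inI (subst (λ a → u ⊑[ O ] proj₁ a) (sym eqi) u⊑x ,
                       subst (λ a → proj₂ a ⊑[ O ] v) (sym eqi) z⊑v))

    reverse-path : ∀ {p q} → u ⊑[ O ] p → p ⊑[ O ] q → q ⊑[ O ] v → q ⊑[ O′ ] p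
    reverse-path u⊑p ε q⊑v = ε
    reverse-path {p} u⊑p (_◅_ {j = r} (i , e) s) q⊑v =
      reverse-path (u⊑p ◅◅ ((i , e) ◅ ε)) s q⊑v ◅◅ ((i , e′) ◅ ε)
      where
      inI : InInterval G O j i
      inI = subst (λ a → u ⊑[ O ] proj₁ a) (sym e) u⊑p ,
            subst (λ a → proj₂ a ⊑[ O ] v) (sym e) (s ◅◅ q⊑v)
      e′ : arcOf G O′ i ≡ (r , p)
      e′ = trans (arcOf-disagree O O′ i (reversed-bit inI)) (cong swap e)

    rev-acyclic : Acyclic G O → Acyclic G O′
    rev-acyclic ac (i , cycle) with inInterval? O j i
    ... | yes (u⊑ , ⊑v) =
      ac (i , proj₁ (path-in-interval u⊑ (subst (λ a → proj₂ a ⊑[ O′ ] proj₁ a) flipped cycle) ⊑v))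
      where
      flipped : arcOf G O′ i ≡ swap (arcOf G O i)
      flipped = arcOf-disagree O O′ i (reversed-bit (u⊑ , ⊑v))
    ... | no ¬inI
      with lift-path (subst (λ a → proj₂ a ⊑[ O′ ] proj₁ a) (arcOf-agree O O′ i (kept-bit ¬inI)) cycle)
    ...   | inj₁ t = ac (i , t)
    ...   | inj₂ (⊑v , u⊑) = ¬inI (u⊑ , ⊑v)

    own-arc-reversed : arcOf G O′ j ≡ swap (arcOf G O j)
    own-arc-reversed = arcOf-disagree O O′ j (reversed-bit (own-interval O j))

    interval-kept : ∀ {i} → InInterval G O j i → InInterval G O′ j i
    interval-kept {i} (u⊑ , ⊑v) =
      subst₂ (λ a b → proj₁ a ⊑[ O′ ] proj₁ b × proj₂ b ⊑[ O′ ] proj₂ a)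
        (sym own-arc-reversed) (sym (arcOf-disagree O O′ i (reversed-bit (u⊑ , ⊑v))))
        (reverse-path (u⊑ ◅◅ arc-path O i) ⊑v ε , reverse-path ε u⊑ (arc-path O i ◅◅ ⊑v))

    outside-kept : ∀ {i} → ¬ InInterval G O j i → ¬ InInterval G O′ j i
    outside-kept {i} ¬inI inI′ =
      let (x⊑ , ⊑y) = subst₂ (λ a b → proj₁ a ⊑[ O′ ] proj₁ b × proj₂ b ⊑[ O′ ] proj₂ a)
                             own-arc-reversed (arcOf-agree O O′ i (kept-bit ¬inI)) inI′
      in ¬inI (either (arc-path O j ◅◅_) proj₂ (lift-path x⊑) ,
               either (_◅◅ arc-path O j) proj₁ (lift-path ⊑y))

    rev-involutive : rev O′ j ≡ O
    rev-involutive = vec-ext _ _ λ i → bit i (inInterval? O j i)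
      where
      bit : ∀ i → Dec (InInterval G O j i) → Vec.lookup (rev O′ j) i ≡ Vec.lookup O i
      bit i (yes inI) = trans (reversed-bit (interval-kept inI))
                              (trans (cong not (reversed-bit inI)) (not-involutive _))
      bit i (no ¬inI) = trans (kept-bit (outside-kept ¬inI)) (kept-bit ¬inI)

    -- the edge j itself is always reversed, so O′ ≠ O
    rev-moves : ¬ O′ ≡ O
    rev-moves e = not-¬ refl (trans (sym (cong (λ w → Vec.lookup w j) e)) (reversed-bit (own-interval O j)))

  open Reversal public using (rev-acyclic; rev-involutive; rev-moves)

module ReversalGraph (G : SimpleGraph) (dec : ReachDec G) where
  open Geometry G
  open WithDec G dec
  open IntervalReversal G dec

  same-reversal⇒in-interval : ∀ O j k → rev O j ≡ rev O k → InInterval G O j k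
  same-reversal⇒in-interval O j k e with inInterval? O j k
  ... | yes inI = inI
  ... | no ¬inI = ⊥-elim (not-¬ refl (begin
    Vec.lookup O k            ≡⟨ sym (kept-bit ¬inI) ⟩
    Vec.lookup (rev O j) k    ≡⟨ cong (λ w → Vec.lookup w k) e ⟩
    Vec.lookup (rev O k) k    ≡⟨ reversed-bit (own-interval O k) ⟩
    not (Vec.lookup O k)      ∎))
    where open ≡-Reasoning

  -- distinct edges give distinct reversals: each lies in the interval of the
  -- other, so their arcs coincide by antisymmetry of ≤_O
  rev-injective : ∀ O → Acyclic G O → ∀ {j k} → rev O j ≡ rev O k → j ≡ k
  rev-injective O ac {j} {k} e =
    let (uj⊑uk , vk⊑vj) = same-reversal⇒in-interval O j k e
        (uk⊑uj , vj⊑vk) = same-reversal⇒in-interval O k j (sym e)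
    in arcOf-injective O (cong₂ _,_ (⊑-antisym {O} ac uj⊑uk uk⊑uj) (⊑-antisym {O} ac vj⊑vk vk⊑vj))

  -- adjacency is symmetric, since each reversal is an involution
  adj-sym : ∀ {O₁ O₂} → Adj O₁ O₂ → Adj O₂ O₁
  adj-sym {O₁} (j , e) = j , subst (λ w → rev w j ≡ O₁) e (rev-involutive O₁ j)

  allVecs-unique : ∀ k → Unique (allVecs k)
  allVecs-unique zero = All.[] ∷ []
  allVecs-unique (suc k) =
    Unique.++⁺ (Unique.map⁺ (cong Vec.tail) (allVecs-unique k))
               (Unique.map⁺ (cong Vec.tail) (allVecs-unique k)) disjoint
    where
    disjoint : ∀ {w} → ¬ (w ∈ map (true Vec.∷_) (allVecs k) × w ∈ map (false Vec.∷_) (allVecs k))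
    disjoint (w∈₁ , w∈₂) with ∈-map⁻ (true Vec.∷_) w∈₁ | ∈-map⁻ (false Vec.∷_) w∈₂
    ... | _ , _ , e₁ | _ , _ , e₂ with trans (sym e₁) e₂
    ... | ()

  allVecs-complete : ∀ {k} (w : Vec Bool k) → w ∈ allVecs k
  allVecs-complete Vec.[] = here refl
  allVecs-complete {suc k} (true Vec.∷ w) = ∈-++⁺ˡ (∈-map⁺ (true Vec.∷_) (allVecs-complete w))
  allVecs-complete {suc k} (false Vec.∷ w) =
    ∈-++⁺ʳ (map (true Vec.∷_) (allVecs k)) (∈-map⁺ (false Vec.∷_) (allVecs-complete w))

  AOs-unique : Unique AOs
  AOs-unique = Unique.filter⁺ acyclic? (allVecs-unique E)

  acyclic⇒∈AOs : ∀ {O} → Acyclic G O → O ∈ AOs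
  acyclic⇒∈AOs ac = ∈-filter⁺ acyclic? (allVecs-complete _) ac

  ∈AOs⇒acyclic : ∀ {O} → O ∈ AOs → Acyclic G O
  ∈AOs⇒acyclic O∈ = proj₂ (∈-filter⁻ acyclic? {xs = allVecs E} O∈)

  -- AO^inter_G is |E|-regular: the neighbours of O are enumerated
  -- without repetition by the |E| reversals  j ↦ O_{e_j}
  deg-regular : ∀ O → Acyclic G O → deg O ≡ E
  deg-regular O ac = length-filter-enumerated (adj? O) AOs AOs-unique (rev O) (rev-injective O ac)
    (λ _ adj → adj) (λ j → acyclic⇒∈AOs (rev-acyclic O j ac)) (λ j → j , refl)

  -- likewise every O′ has exactly |E| in-neighbours, namely the  O′_{e_j}
  in-degree-regular : ∀ O′ → Acyclic G O′ → length (filter (λ O → adj? O O′) AOs) ≡ E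
  in-degree-regular O′ ac′ = length-filter-enumerated (λ O → adj? O O′) AOs AOs-unique (rev O′)
    (rev-injective O′ ac′) (λ _ adj → adj-sym adj) (λ j → acyclic⇒∈AOs (rev-acyclic O′ j ac′))
    (λ j → adj-sym (j , refl))

  -- Connectivity: every acyclic O is joined to a fixed acyclic target O₂ by
  -- induction on the number of edges where O and O₂ disagree.
  module Connect (O₂ : Orientation G) (ac₂ : Acyclic G O₂) where

    Disagree : Orientation G → Fin E → Set
    Disagree O i = ¬ Vec.lookup O i ≡ Vec.lookup O₂ i

    disagree? : ∀ O i → Dec (Disagree O i)
    disagree? O i = ¬? (Vec.lookup O i ≟B Vec.lookup O₂ i)

    distance : Orientation G → ℕ
    distance O = length (filter (disagree? O) (allFin E))

    interval-size : Orientation G → Fin E → ℕ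
    interval-size O j = length (filter (inInterval? O j) (allFin E))

    agree-arc : ∀ O i → Vec.lookup O i ≡ Vec.lookup O₂ i → arcOf G O₂ i ≡ arcOf G O i
    agree-arc O i e = arcOf-agree O O₂ i (sym e)

    flipped-arc : ∀ O i → Disagree O i → arcOf G O₂ i ≡ swap (arcOf G O i)
    flipped-arc O i d = arcOf-disagree O O₂ i (¬-not (λ e → d (sym e)))

    crossing : ∀ O {x y} → x ⊑[ O ] y → x ⊑[ O₂ ] y ⊎
      (∃ λ k → Disagree O k × x ⊑[ O ] proj₁ (arcOf G O k) × proj₂ (arcOf G O k) ⊑[ O ] y)
    crossing O ε = inj₁ ε
    crossing O {x} {y} ((i , e) ◅ s) with Vec.lookup O i ≟B Vec.lookup O₂ i | crossing O s
    ... | no ne | _ = inj₂ (i , ne , subst (λ a → x ⊑[ O ] proj₁ a) (sym e) ε ,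
                                     subst (λ a → proj₂ a ⊑[ O ] y) (sym e) s)
    ... | yes eq | inj₁ t = inj₁ ((i , trans (agree-arc O i eq) e) ◅ t)
    ... | yes eq | inj₂ (k , dk , x⊑ , ⊑y) = inj₂ (k , dk , (i , e) ◅ x⊑ , ⊑y)

    -- if j disagrees and its interval contains another edge, then it contains
    -- the interval of another disagreeing edge k ≠ j: otherwise the arc (u , v)
    -- of j would be recovered by an O₂-path, closing a cycle in O₂
    inner-disagreement : ∀ O → Acyclic G O → ∀ j → Disagree O j → ∀ i → InInterval G O j i → ¬ i ≡ j →
      ∃ λ k → Disagree O k × InInterval G O j k × ¬ k ≡ j
    inner-disagreement O ac j dj i (u⊑ , ⊑v) i≢j
      with Vec.lookup O i ≟B Vec.lookup O₂ i | crossing O u⊑ | crossing O ⊑v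
    ... | no di | _ | _ = i , di , (u⊑ , ⊑v) , i≢j
    ... | yes _ | inj₂ (k , dk , u⊑k , k⊑x) | _ =
      k , dk , (u⊑k , k⊑x ◅◅ arc-path O i ◅◅ ⊑v) , λ { refl → ac (i , ⊑v ◅◅ k⊑x) }
    ... | yes _ | inj₁ _ | inj₂ (k , dk , y⊑k , k⊑v) =
      k , dk , (u⊑ ◅◅ arc-path O i ◅◅ y⊑k , k⊑v) , λ { refl → ac (i , y⊑k ◅◅ u⊑) }
    ... | yes ai | inj₁ t₁ | inj₁ t₂ =
      ⊥-elim (ac₂ (j , subst (λ a → proj₂ a ⊑[ O₂ ] proj₁ a) (sym (flipped-arc O j dj))
                             (t₁ ◅◅ (i , agree-arc O i ai) ◅ t₂)))

    minimal-disagreement : ∀ O → Acyclic G O → ∀ j → Acc _<_ (interval-size O j) → Disagree O j →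
      ∃ λ m → Disagree O m × (∀ i → InInterval G O m i → i ≡ m)
    minimal-disagreement O ac j (acc smaller) dj
      with any? (λ i → inInterval? O j i ×-dec ¬? (i ≟F j))
    ... | no ¬other = j , dj , λ i inI → decidable-stable (i ≟F j) (λ i≢j → ¬other (i , inI , i≢j))
    ... | yes (i , inI , i≢j) with inner-disagreement O ac j dj i inI i≢j
    ...   | k , dk , (u⊑k , k⊑v) , k≢j = minimal-disagreement O ac k (smaller shrinks) dk
      where
      nested : ∀ i′ → InInterval G O k i′ → InInterval G O j i′
      nested i′ (k⊑ , ⊑k) = u⊑k ◅◅ k⊑ , ⊑k ◅◅ k⊑v
      j∉k : ¬ InInterval G O k j
      j∉k (k⊑u , v⊑k) =
        k≢j (arcOf-injective O (cong₂ _,_ (⊑-antisym {O} ac k⊑u u⊑k) (⊑-antisym {O} ac k⊑v v⊑k)))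
      shrinks : interval-size O k < interval-size O j
      shrinks = length-filter-mono-< (inInterval? O j) (inInterval? O k) nested
                                     (allFin E) (∈-allFin j) (own-interval O j) j∉k

    -- reversing a minimal disagreeing edge fixes it and changes nothing else
    connect : ∀ O → Acyclic G O → Acc _<_ (distance O) → Star Adj O O₂
    connect O ac (acc closer) with any? (disagree? O)
    ... | no ¬some = subst (Star Adj O) (vec-ext O O₂ λ i →
                       decidable-stable (Vec.lookup O i ≟B Vec.lookup O₂ i) (λ di → ¬some (i , di))) ε
    ... | yes (j₀ , d₀) with minimal-disagreement O ac j₀ (<-wellFounded _) d₀
    ...   | j , dj , minimal = (j , refl) ◅ connect (rev O j) (rev-acyclic O j ac) (closer fewer)
      where
      O′ : Orientation G
      O′ = rev O j
      kept : ∀ i → Disagree O′ i → Disagree O i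
      kept i d′ with i ≟F j
      ... | yes refl = dj
      ... | no i≢j = λ e → d′ (trans (kept-bit (λ inI → i≢j (minimal i inI))) e)
      fixed : ¬ Disagree O′ j
      fixed d′ = d′ (trans (reversed-bit (own-interval O j)) (sym (¬-not (λ e → dj (sym e)))))
      fewer : distance O′ < distance O
      fewer = length-filter-mono-< (disagree? O) (disagree? O′) kept (allFin E) (∈-allFin j) dj fixed

  connected : ∀ O₁ O₂ → Acyclic G O₁ → Acyclic G O₂ → Star Adj O₁ O₂
  connected O₁ O₂ ac₁ ac₂ = Connect.connect O₂ ac₂ O₁ ac₁ (<-wellFounded _)

module Walk (G : SimpleGraph) (dec : ReachDec G) where
  open WithDec G dec
  open IntervalReversal G dec
  open ReversalGraph G dec
  open RationalSums

  ratio-zero : ∀ d → ratio 0 d ≡ 0ℚ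
  ratio-zero zero = refl
  ratio-zero (suc d) = ℚP.0/n≡0 (suc d)

  ratio-nonNeg : ∀ a d → ℚ.NonNegative (ratio a d)
  ratio-nonNeg a zero = _
  ratio-nonNeg a (suc d) = ℚP.normalize-nonNeg a (suc d)

  -- by injectivity of  j ↦ O_{e_j},  at most one edge moves O to O′
  moving-edges : ∀ O O′ → Acyclic G O →
    length (filter (λ j → rev O j ≟O O′) (allFin E)) ≡ (if does (adj? O O′) then 1 else 0)
  moving-edges O O′ ac with adj? O O′
  ... | yes (j , e) =
    length-filter-enumerated (λ j → rev O j ≟O O′) (allFin E) (Unique.allFin⁺ E) (λ (_ : Fin 1) → j)
      (λ { {Fin.zero} {Fin.zero} _ → refl }) (λ k e′ → Fin.zero , rev-injective O ac (trans e (sym e′)))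
      (λ _ → ∈-allFin j) (λ _ → e)
  ... | no ¬adj =
    length-filter-enumerated (λ j → rev O j ≟O O′) (allFin E) (Unique.allFin⁺ E) (λ ())
      (λ { {()} }) (λ k e → ⊥-elim (¬adj (k , e))) (λ ()) (λ ())

  P-IR-adjacency : ∀ O O′ → Acyclic G O → P-IR O O′ ≡ (if does (adj? O O′) then ratio 1 E else 0ℚ)
  P-IR-adjacency O O′ ac = trans (cong (λ c → ratio c E) (moving-edges O O′ ac)) (by-cases (does (adj? O O′)))
    where
    by-cases : ∀ b → ratio (if b then 1 else 0) E ≡ (if b then ratio 1 E else 0ℚ)
    by-cases true = refl
    by-cases false = ratio-zero E

  -- as every vertex has degree |E|, this is the simple random walk
  P-IR≡P-SRW : ∀ O O′ → Acyclic G O → P-IR O O′ ≡ P-SRW O O′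
  P-IR≡P-SRW O O′ ac = trans (P-IR-adjacency O O′ ac)
    (cong (λ d → if does (adj? O O′) then ratio 1 d else 0ℚ) (sym (deg-regular O ac)))

  module Nonempty (e : ℕ) (E≡1+e : E ≡ suc e) where

    step : ℚ
    step = (+ 1) / suc e

    step-probability : ∀ {O O′} → Acyclic G O → Adj O O′ → P-IR O O′ ≡ step
    step-probability {O} {O′} ac adj = trans (P-IR-adjacency O O′ ac) (by-cases (adj? O O′))
      where
      by-cases : (d : Dec (Adj O O′)) → (if does d then ratio 1 E else 0ℚ) ≡ step
      by-cases (yes _) = cong (ratio 1) E≡1+e
      by-cases (no ¬adj) = ⊥-elim (¬adj adj)

    -- columns of the transition matrix sum to 1 (each O′ has |E| in-neighbours)
    column-sum : ∀ c O′ → Acyclic G O′ → sum (map (λ O → c ℚ.* P-IR O O′) AOs) ≡ c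
    column-sum c O′ ac′ = begin
      sum (map (λ O → c ℚ.* P-IR O O′) AOs)
        ≡⟨ sum-cong AOs _ _ (λ O∈ → cong (c ℚ.*_) (P-IR-adjacency _ O′ (∈AOs⇒acyclic O∈))) ⟩
      sum (map (λ O → c ℚ.* (if does (adj? O O′) then ratio 1 E else 0ℚ)) AOs)
        ≡⟨ sum-indicator (λ O → adj? O O′) c (ratio 1 E) AOs ⟩
      c ℚ.* times (length (filter (λ O → adj? O O′) AOs)) (ratio 1 E)
        ≡⟨ cong₂ (λ k r → c ℚ.* times k r)
                 (trans (in-degree-regular O′ ac′) E≡1+e) (cong (ratio 1) E≡1+e) ⟩
      c ℚ.* times (suc e) step
        ≡⟨ cong (c ℚ.*_) (times-unit-fraction e) ⟩
      c ℚ.* 1ℚ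
        ≡⟨ ℚP.*-identityʳ c ⟩
      c ∎
      where open ≡-Reasoning

    #AOℚ : ℚ
    #AOℚ = (+ #AO) / 1

    uniform⇒stationary : ∀ μ → (∀ O → Acyclic G O → μ O ℚ.* #AOℚ ≡ 1ℚ) → IsStationaryIR μ
    uniform⇒stationary μ uniform O′ ac′ = trans
      (sum-cong AOs _ (λ O → μ O′ ℚ.* P-IR O O′)
        (λ {O} O∈ → cong (ℚ._* P-IR O O′)
          (inverse-unique {μ O} {μ O′} {#AOℚ} (uniform O (∈AOs⇒acyclic O∈)) (uniform O′ ac′))))
      (column-sum (μ O′) O′ ac′)

    -- Maximum principle: for a stationary μ, the value at a maximiser spreads
    -- to its neighbours, since μ(O₁) is the average of μ over the neighbours of O₁.
    module MaximumPrinciple (μ : Orientation G → ℚ) (stationary : IsStationaryIR μ)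
                            (M : ℚ) (bounded : ∀ {O} → O ∈ AOs → μ O ℚ.≤ M) where

      spreads : ∀ {O₁ O₂} → Acyclic G O₁ → μ O₁ ≡ M → Adj O₁ O₂ → μ O₂ ≡ M
      spreads {O₁} {O₂} ac₁ μO₁≡M adj@(j , refl) =
        unit-fraction-cancel e (begin
          μ O₂ ℚ.* step           ≡⟨ cong (μ O₂ ℚ.*_) (sym back) ⟩
          μ O₂ ℚ.* P-IR O₂ O₁     ≡⟨ pointwise ⟩
          M ℚ.* P-IR O₂ O₁        ≡⟨ cong (M ℚ.*_) back ⟩
          M ℚ.* step              ∎)
        where
        open ≡-Reasoning
        ac₂ : Acyclic G O₂
        ac₂ = rev-acyclic O₁ j ac₁
        back : P-IR O₂ O₁ ≡ step
        back = step-probability ac₂ (adj-sym adj)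
        below : ∀ {O} → O ∈ AOs → μ O ℚ.* P-IR O O₁ ℚ.≤ M ℚ.* P-IR O O₁
        below O∈ = ℚP.*-monoʳ-≤-nonNeg (P-IR _ O₁) {{ratio-nonNeg _ E}} (bounded O∈)
        sums : sum (map (λ O → μ O ℚ.* P-IR O O₁) AOs) ≡ sum (map (λ O → M ℚ.* P-IR O O₁) AOs)
        sums = trans (stationary O₁ ac₁) (trans μO₁≡M (sym (column-sum M O₁ ac₁)))
        pointwise : μ O₂ ℚ.* P-IR O₂ O₁ ≡ M ℚ.* P-IR O₂ O₁
        pointwise = sum-equality-pointwise AOs _ _ below sums (acyclic⇒∈AOs ac₂)

      spreads-along : ∀ {O₁ O₂} → Acyclic G O₁ → μ O₁ ≡ M → Star Adj O₁ O₂ → μ O₂ ≡ M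
      spreads-along ac₁ μO₁≡M ε = μO₁≡M
      spreads-along {O₁} ac₁ μO₁≡M (adj@(j , refl) ◅ path) =
        spreads-along (rev-acyclic O₁ j ac₁) (spreads ac₁ μO₁≡M adj) path

    maximiser : ∀ (μ : Orientation G → ℚ) xs → sum (map μ xs) ≡ 1ℚ →
                ∃ λ O → O ∈ xs × (∀ {O′} → O′ ∈ xs → μ O′ ℚ.≤ μ O)
    maximiser μ [] ()
    maximiser μ (x ∷ xs) _ = argmax μ x xs

    stationary⇒uniform : ∀ μ → IsDistribution μ → IsStationaryIR μ →
                         ∀ O → Acyclic G O → μ O ℚ.* #AOℚ ≡ 1ℚ
    stationary⇒uniform μ (_ , total) stationary O ac with maximiser μ AOs total
    ... | O* , O*∈ , bounded = begin
      μ O ℚ.* #AOℚ                ≡⟨ cong (ℚ._* #AOℚ) (constant (reach (acyclic⇒∈AOs ac))) ⟩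
      M ℚ.* #AOℚ                  ≡⟨ cong (M ℚ.*_) (sym (times-one #AO)) ⟩
      M ℚ.* times #AO 1ℚ          ≡⟨ sym (times-scale #AO M) ⟩
      times #AO M                 ≡⟨ sym (sum-const AOs M) ⟩
      sum (map (λ _ → M) AOs)     ≡⟨ sum-cong AOs _ _ (λ O′∈ → sym (constant (reach O′∈))) ⟩
      sum (map μ AOs)             ≡⟨ total ⟩
      1ℚ                          ∎
      where
      open ≡-Reasoning
      M : ℚ
      M = μ O*
      ac* : Acyclic G O*
      ac* = ∈AOs⇒acyclic O*∈
      open MaximumPrinciple μ stationary M bounded
      constant : ∀ {O′} → Star Adj O* O′ → μ O′ ≡ M
      constant = spreads-along ac* refl
      reach : ∀ {O′} → O′ ∈ AOs → Star Adj O* O′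
      reach O′∈ = connected O* _ ac* (∈AOs⇒acyclic O′∈)

theorem5p15 : (G : SimpleGraph) →
      ReachDec G ×
      ((dec : ReachDec G) → let open WithDec G dec in
        -- interval reversal maps acyclic orientations to acyclic ones
        (∀ O j → Acyclic G O → Acyclic G (rev O j)) ×
        -- AO^inter_G is a simple graph: no loops, symmetric adjacency
        (∀ O → Acyclic G O → ¬ Adj O O) ×
        (∀ O₁ O₂ → Acyclic G O₁ → Acyclic G O₂ → Adj O₁ O₂ → Adj O₂ O₁) ×
        -- it is |E|-regular
        (∀ O → Acyclic G O → deg O ≡ #E G) ×
        -- it is connected
        (∀ O₁ O₂ → Acyclic G O₁ → Acyclic G O₂ → Star Adj O₁ O₂) ×
        -- when the walk is defined (E nonempty): it is the simple random walk
        -- on AO^inter_G, and its stationary distribution is uniform 1/|χ_G(-1)|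
        (1 ≤ #E G →
          (∀ O O′ → Acyclic G O → Acyclic G O′ → P-IR O O′ ≡ P-SRW O O′) ×
          (∀ (μ : Orientation G → ℚ) → IsDistribution μ →
            (IsStationaryIR μ ⇔ (∀ O → Acyclic G O → μ O ℚ.* ((+ #AO) / 1) ≡ 1ℚ)))))
theorem5p15 G = Geometry.reachDec G , λ dec →
  let open IntervalReversal G dec
      open ReversalGraph G dec
      open Walk G dec
  in rev-acyclic ,
     (λ O _ (j , loop) → rev-moves O j loop) ,
     (λ _ _ _ _ → adj-sym) ,
     deg-regular ,
     connected ,
     λ E≥1 → let (e , E≡1+e) = positive⇒suc E≥1
                 open Nonempty e E≡1+e
             in (λ O O′ ac _ → P-IR≡P-SRW O O′ ac) ,
                (λ μ distribution → mk⇔ (stationary⇒uniform μ distribution) (uniform⇒stationary μ))
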